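{- Let $\Gamma$ be a $k$-regular graph with $k\geqslant 3$, let $G\leqslant\mathrm{Aut}(\Gamma)$, and let $s\geqslant1$ be such that $\Gamma$ is $(G,s)$-distance-transitive and $s$ is less than the diameter of $\Gamma$. For $\alpha\in V\Gamma$, $1\leqslant i\leqslant s$ and $\beta\in\Gamma_i(\alpha)$ put $c_i(\alpha)=|\Gamma_1(\beta)\cap\Gamma_{i-1}(\alpha)|$, $a_i(\alpha)=|\Gamma_1(\beta)\cap\Gamma_i(\alpha)|$, $b_i(\alpha)=|\Gamma_1(\beta)\cap\Gamma_{i+1}(\alpha)|$, $b_0(\alpha)=k$; for a $G_\alpha$-orbit $\Delta\subseteq\Gamma_{s+1}(\alpha)$ and $\delta\in\Delta$ put $c_s'(\alpha,\Delta)=|\Gamma_1(\delta)\cap\Gamma_s(\alpha)|$, and let $c_s'(\alpha)=\min\{c_s'(\alpha,\Delta)\mid \Delta \text{ a } G_\alpha\text{ -orbit in }\Gamma_{s+1}(\alpha)\}$. Then these numbers are well defined (independent of the choices of $\beta$ and $\delta$) and independent of $\alpha$; writing $c_i,a_i,b_i,c_s'$ for them, we have \[1=c_1\leqslant c_2\leqslant\cdots\leqslant c_s\leqslant c_s',\qquad k=b_0>b_1\geqslant b_2\geqslant\cdots\geqslant b_s.\]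
   Context: Graphs are finite, simple, connected, undirected. $\partial_\Gamma(u,v)$ is the distance between $u$ and $v$, and $\Gamma_i(v)$ is the set of vertices at distance $i$ from $v$. For $G\leqslant\mathrm{Aut}(\Gamma)$ and $s\geqslant1$, $\Gamma$ is $(G,s)$-distance-transitive if for each $1\leqslant i\leqslant s$, $G$ is transitive on the ordered pairs $(u,v)$ with $\partial_\Gamma(u,v)=i$. $G_\alpha$ is the stabilizer of $\alpha$ in $G$. -}

module Defs where

open import Data.Nat using (ℕ; zero; suc; _+_; _⊔_; _≤_; _<_)
open import Data.Bool using (Bool; true; false; _∧_; _∨_; if_then_else_)
open import Data.Fin using (Fin; zero; suc; _≟_)
open import Data.Fin.Permutation using (Permutation′; _⟨$⟩ʳ_; id; flip; _∘ₚ_; _≈_)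
open import Data.Product using (Σ; ∃; _×_; _,_)
open import Relation.Nullary.Decidable using (⌊_⌋)
open import Relation.Binary.PropositionalEquality using (_≡_)

record Graph : Set where
  field
    n       : ℕ
    adj     : Fin n → Fin n → Bool
    sym     : ∀ u v → adj u v ≡ adj v u
    irrefl  : ∀ v → adj v v ≡ false
open Graph public

count : ∀ {m} → (Fin m → Bool) → ℕ
count {zero}  p = 0
count {suc m} p = (if p zero then 1 else 0) + count (λ x → p (suc x))

anyF : ∀ {m} → (Fin m → Bool) → Bool
anyF {zero}  p = false
anyF {suc m} p = p zero ∨ anyF (λ x → p (suc x))

maxF : ∀ {m} → (Fin m → ℕ) → ℕ
maxF {zero}  f = 0
maxF {suc m} f = f zero ⊔ maxF (λ x → f (suc x))

module _ (Γ : Graph) where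

  reach : ℕ → Fin (n Γ) → Fin (n Γ) → Bool
  reach zero    u v = ⌊ u ≟ v ⌋
  reach (suc d) u v = reach d u v ∨ anyF (λ w → reach d u w ∧ adj Γ w v)

  -- least d < m with p d, or m if there is none
  firstTrue : (ℕ → Bool) → ℕ → ℕ
  firstTrue p zero    = zero
  firstTrue p (suc m) = if p zero then zero else suc (firstTrue (λ d → p (suc d)) m)

  -- graph distance ∂(u,v) = length of a shortest path (for connected graphs
  -- a shortest path has length < n, so the search bound n is harmless)
  dist : Fin (n Γ) → Fin (n Γ) → ℕ
  dist u v = firstTrue (λ d → reach d u v) (n Γ)

  Connected : Set
  Connected = ∀ u v → ∃ λ d → reach d u v ≡ true

  diameter : ℕ
  diameter = maxF (λ u → maxF (λ v → dist u v))

  degree : Fin (n Γ) → ℕ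
  degree v = count (adj Γ v)

  Regular : ℕ → Set
  Regular k = ∀ v → degree v ≡ k

  nbrsAt : Fin (n Γ) → Fin (n Γ) → ℕ → ℕ
  nbrsAt α β j = count (λ w → adj Γ β w ∧ ⌊ dist α w Data.Nat.≟ j ⌋)

  IsAut : Permutation′ (n Γ) → Set
  IsAut π = ∀ u v → adj Γ (π ⟨$⟩ʳ u) (π ⟨$⟩ʳ v) ≡ adj Γ u v

  record Subgroup : Set₁ where
    field
      mem     : Permutation′ (n Γ) → Set
      resp    : ∀ {π ρ} → π ≈ ρ → mem π → mem ρ
      aut     : ∀ {π} → mem π → IsAut π
      id∈     : mem id
      comp∈   : ∀ {π ρ} → mem π → mem ρ → mem (π ∘ₚ ρ)
      inv∈    : ∀ {π} → mem π → mem (flip π)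
  open Subgroup public

  DistTransitive : Subgroup → ℕ → Set
  DistTransitive G s = ∀ i → 1 ≤ i → i ≤ s → ∀ u v u′ v′ →
    dist u v ≡ i → dist u′ v′ ≡ i →
    Σ (Permutation′ (n Γ)) λ g → mem G g × (g ⟨$⟩ʳ u ≡ u′) × (g ⟨$⟩ʳ v ≡ v′)

  SameOrbitStab : Subgroup → Fin (n Γ) → Fin (n Γ) → Fin (n Γ) → Set
  SameOrbitStab G α δ δ′ =
    Σ (Permutation′ (n Γ)) λ g → mem G g × (g ⟨$⟩ʳ α ≡ α) × (g ⟨$⟩ʳ δ ≡ δ′)

module Submission where

-- Every count |Γ₁(β) ∩ Γⱼ(α)| is invariant under
-- automorphisms, and G is transitive on the pairs at distance i ≤ s, so such a
-- count depends only on i = ∂(α,β); we name it by the "common value" of the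
-- count over all pairs at distance i.  G is in particular vertex-transitive,
-- so the minimum c′ of |Γ₁(δ) ∩ Γₛ(α)| over δ ∈ Γₛ₊₁(α) does not depend on α.
-- The inequalities come from two containments valid in any graph: if α ~ α′
-- then Γ₁(β) ∩ Γⱼ(α′) ⊆ Γ₁(β) ∩ Γⱼ₊₁(α) when ∂(α,β) = j+2 (so c grows), and
-- Γ₁(β) ∩ Γᵢ₊₂(α) ⊆ Γ₁(β) ∩ Γᵢ₊₁(α′) when ∂(α′,β) = i (so b shrinks); b₁ < k
-- because α itself is a neighbour of β outside Γ₂(α).

open import Defs renaming (sym to adj-sym)
open import Data.Nat using (ℕ; zero; suc; _∸_; _≤_; _<_; _+_; z≤n; s≤s; _<?_; _≤?_)
  renaming (_≟_ to _≟ℕ_)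
open import Data.Nat.Properties
open import Data.Fin using (Fin; zero; suc) renaming (_≟_ to _≟F_)
open import Data.Fin.Properties using () renaming (suc-injective to Fin-suc-injective)
open import Data.Fin.Permutation using (Permutation′; _⟨$⟩ʳ_; _⟨$⟩ˡ_; inverseʳ)
open import Data.Product using (Σ; _×_; _,_; proj₁; proj₂)
open import Data.Sum using (_⊎_; inj₁; inj₂)
open import Data.Bool using (Bool; true; false; _∧_; _∨_; if_then_else_; not)
open import Data.Bool.Properties using (∧-conicalˡ; ∧-conicalʳ; ∧-zeroʳ)
open import Data.Empty using (⊥; ⊥-elim)
open import Function using (_∘_)
open import Function.Bundles using (Injection)
open import Function.Properties.Inverse using (↔⇒↣)
open import Relation.Nullary using (yes; no)
open import Relation.Nullary.Decidable using (⌊_⌋)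
open import Relation.Binary.PropositionalEquality
import Algebra.Properties.CommutativeMonoid.Sum as MonoidSum

open MonoidSum +-0-commutativeMonoid using (sum; sum-permute)

true≢false : ∀ {b} → b ≡ true → b ≡ false → ⊥
true≢false refl ()

∨-split : ∀ a b → a ∨ b ≡ true → a ≡ true ⊎ b ≡ true
∨-split true  b _ = inj₁ refl
∨-split false b e = inj₂ e

∨-introˡ : ∀ {a} b → a ≡ true → a ∨ b ≡ true
∨-introˡ b refl = refl

∨-introʳ : ∀ a {b} → b ≡ true → a ∨ b ≡ true
∨-introʳ true  _ = refl
∨-introʳ false e = e

∧-intro : ∀ {a b} → a ≡ true → b ≡ true → a ∧ b ≡ true
∧-intro refl refl = refl

not-false : ∀ {b} → (b ≡ false → ⊥) → b ≡ true
not-false {true}  _ = refl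
not-false {false} h = ⊥-elim (h refl)

bool-ext : ∀ {a b} → (a ≡ true → b ≡ true) → (b ≡ true → a ≡ true) → a ≡ b
bool-ext {true}  {true}  f g = refl
bool-ext {true}  {false} f g = sym (f refl)
bool-ext {false} {true}  f g = g refl
bool-ext {false} {false} f g = refl

≟-sound : ∀ {x y} → ⌊ x ≟ℕ y ⌋ ≡ true → x ≡ y
≟-sound {x} {y} e with x ≟ℕ y
... | yes x≡y = x≡y
... | no  _   = ⊥-elim (true≢false e refl)

≟-complete : ∀ {x y} → x ≡ y → ⌊ x ≟ℕ y ⌋ ≡ true
≟-complete {x} {y} e with x ≟ℕ y
... | yes _   = refl
... | no  x≢y = ⊥-elim (x≢y e)

anyF-witness : ∀ {m} (p : Fin m → Bool) → anyF p ≡ true → Σ (Fin m) λ x → p x ≡ true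
anyF-witness {suc m} p e with ∨-split (p zero) _ e
... | inj₁ p0 = zero , p0
... | inj₂ ps with anyF-witness (p ∘ suc) ps
...   | x , px = suc x , px

anyF-intro : ∀ {m} (p : Fin m → Bool) x → p x ≡ true → anyF p ≡ true
anyF-intro p zero    px = ∨-introˡ _ px
anyF-intro p (suc x) px = ∨-introʳ (p zero) (anyF-intro (p ∘ suc) x px)

anyF-cong : ∀ {m} {p q : Fin m → Bool} → (∀ x → p x ≡ q x) → anyF p ≡ anyF q
anyF-cong {zero}  e = refl
anyF-cong {suc m} e = cong₂ _∨_ (e zero) (anyF-cong (e ∘ suc))

anyF-permute : ∀ {m} (p : Fin m → Bool) (π : Permutation′ m) → anyF (p ∘ (π ⟨$⟩ʳ_)) ≡ anyF p
anyF-permute p π = bool-ext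
  (λ e → let (x , px) = anyF-witness (p ∘ (π ⟨$⟩ʳ_)) e in anyF-intro p _ px)
  (λ e → let (x , px) = anyF-witness p e in
     anyF-intro (p ∘ (π ⟨$⟩ʳ_)) (π ⟨$⟩ˡ x) (trans (cong p (inverseʳ π)) px))

count-cong : ∀ {m} {p q : Fin m → Bool} → (∀ x → p x ≡ q x) → count p ≡ count q
count-cong {zero}  e = refl
count-cong {suc m} e =
  cong₂ (λ b r → (if b then 1 else 0) + r) (e zero) (count-cong (e ∘ suc))

count-mono : ∀ {m} (p q : Fin m → Bool) → (∀ x → p x ≡ true → q x ≡ true) → count p ≤ count q
count-mono {zero}  p q p⊆q = z≤n
count-mono {suc m} p q p⊆q with p zero in p0 | q zero in q0
... | true  | true  = s≤s (count-mono _ _ (p⊆q ∘ suc))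
... | false | true  = m≤n⇒m≤1+n (count-mono _ _ (p⊆q ∘ suc))
... | false | false = count-mono _ _ (p⊆q ∘ suc)
... | true  | false = ⊥-elim (true≢false (p⊆q zero p0) q0)

count-strict : ∀ {m} (p q : Fin m → Bool) → (∀ x → p x ≡ true → q x ≡ true) →
  ∀ x → p x ≡ false → q x ≡ true → count p < count q
count-strict p q p⊆q zero px qx rewrite px | qx = s≤s (count-mono _ _ (p⊆q ∘ suc))
count-strict {suc m} p q p⊆q (suc x) px qx with p zero in p0 | q zero in q0
... | true  | true  = s≤s (count-strict _ _ (p⊆q ∘ suc) x px qx)
... | false | true  = m≤n⇒m≤1+n (count-strict _ _ (p⊆q ∘ suc) x px qx)
... | false | false = count-strict _ _ (p⊆q ∘ suc) x px qx
... | true  | false = ⊥-elim (true≢false (p⊆q zero p0) q0)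

count-all : ∀ m → count {m} (λ _ → true) ≡ m
count-all zero    = refl
count-all (suc m) = cong suc (count-all m)

count-≤ : ∀ {m} (p : Fin m → Bool) → count p ≤ m
count-≤ {m} p = subst (count p ≤_) (count-all m) (count-mono p _ (λ _ _ → refl))

count-full : ∀ {m} (p : Fin m → Bool) → count p ≡ m → ∀ x → p x ≡ true
count-full {m} p full x with p x in px
... | true  = refl
... | false = ⊥-elim (<-irrefl (trans full (sym (count-all m)))
                (count-strict p (λ _ → true) (λ _ _ → refl) x px refl))

count-positive : ∀ {m} (p : Fin m → Bool) x → p x ≡ true → 1 ≤ count p
count-positive p zero px rewrite px = s≤s z≤n
count-positive {suc m} p (suc x) px = ≤-trans (count-positive (p ∘ suc) x px) (m≤n+m _ _)

count-witness : ∀ {m} (p : Fin m → Bool) → 1 ≤ count p → Σ (Fin m) λ x → p x ≡ true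
count-witness {suc m} p pos with p zero in p0
... | true  = zero , p0
... | false with count-witness (p ∘ suc) pos
...   | x , px = suc x , px

count-none : ∀ {m} (p : Fin m → Bool) → (∀ x → p x ≡ false) → count p ≡ 0
count-none {zero}  p none = refl
count-none {suc m} p none rewrite none zero = count-none (p ∘ suc) (none ∘ suc)

count-single : ∀ {m} (p : Fin m → Bool) a → p a ≡ true → (∀ x → p x ≡ true → x ≡ a) → count p ≡ 1
count-single p zero pa unique rewrite pa = cong suc (count-none (p ∘ suc) others)
  where
  others : ∀ x → p (suc x) ≡ false
  others x with p (suc x) in px
  ... | true  with () ← unique (suc x) px
  ... | false = refl
count-single {suc m} p (suc a) pa unique with p zero in p0
... | true  with () ← unique zero p0
... | false = count-single (p ∘ suc) a pa (λ x px → Fin-suc-injective (unique (suc x) px))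

count-as-sum : ∀ {m} (p : Fin m → Bool) → count p ≡ sum (λ x → if p x then 1 else 0)
count-as-sum {zero}  p = refl
count-as-sum {suc m} p = cong ((if p zero then 1 else 0) +_) (count-as-sum (p ∘ suc))

count-permute : ∀ {m} (p : Fin m → Bool) (π : Permutation′ m) → count (p ∘ (π ⟨$⟩ʳ_)) ≡ count p
count-permute p π = begin
  count (p ∘ (π ⟨$⟩ʳ_))                              ≡⟨ count-as-sum (p ∘ (π ⟨$⟩ʳ_)) ⟩
  sum (λ x → if p (π ⟨$⟩ʳ x) then 1 else 0)          ≡⟨ sum-permute (λ x → if p x then 1 else 0) π ⟨
  sum (λ x → if p x then 1 else 0)                   ≡⟨ count-as-sum p ⟨
  count p                                            ∎
  where open ≡-Reasoning

maxF-upper : ∀ {m} (f : Fin m → ℕ) x → f x ≤ maxF f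
maxF-upper f zero    = m≤m⊔n _ _
maxF-upper f (suc x) = ≤-trans (maxF-upper (f ∘ suc) x) (m≤n⊔m _ _)

maxF-least : ∀ {m} (f : Fin m → ℕ) v → (∀ x → f x ≤ v) → maxF f ≤ v
maxF-least {zero}  f v bound = z≤n
maxF-least {suc m} f v bound = ⊔-lub (bound zero) (maxF-least (f ∘ suc) v (bound ∘ suc))

maxF-witness : ∀ {m} (f : Fin m → ℕ) v → v < maxF f → Σ (Fin m) λ x → v < f x
maxF-witness {suc m} f v v<max with v <? f zero
... | yes v<f0 = zero , v<f0
... | no  v≮f0 with maxF-witness (f ∘ suc) v
                     (≰⇒> λ tail≤v → <⇒≱ v<max (⊔-lub (≮⇒≥ v≮f0) tail≤v))
...   | x , v<fx = suc x , v<fx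

minimum-or-empty : ∀ {m} (P : Fin m → Bool) (f : Fin m → ℕ) →
  (Σ (Fin m) λ y → P y ≡ true × (∀ z → P z ≡ true → f y ≤ f z)) ⊎ (∀ z → P z ≡ false)
minimum-or-empty {zero} P f = inj₂ λ ()
minimum-or-empty {suc m} P f with minimum-or-empty (P ∘ suc) (f ∘ suc) | P zero in p0
... | inj₂ none | false = inj₂ λ { zero → p0 ; (suc z) → none z }
... | inj₂ none | true  =
  inj₁ (zero , p0 , λ { zero _ → ≤-refl ; (suc z) pz → ⊥-elim (true≢false pz (none z)) })
... | inj₁ (y , py , least) | false =
  inj₁ (suc y , py , λ { zero pz → ⊥-elim (true≢false pz p0) ; (suc z) pz → least z pz })
... | inj₁ (y , py , least) | true with f zero ≤? f (suc y)
...   | yes f0≤ = inj₁ (zero , p0 , λ { zero _ → ≤-refl ; (suc z) pz → ≤-trans f0≤ (least z pz) })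
...   | no  f0≰ = inj₁ (suc y , py , λ { zero _ → <⇒≤ (≰⇒> f0≰) ; (suc z) pz → least z pz })

argmin : ∀ {m} (P : Fin m → Bool) (f : Fin m → ℕ) x → P x ≡ true →
  Σ (Fin m) λ y → P y ≡ true × (∀ z → P z ≡ true → f y ≤ f z)
argmin P f x px with minimum-or-empty P f
... | inj₁ least = least
... | inj₂ none  = ⊥-elim (true≢false px (none x))

module FirstTrue (Γ : Graph) where

  firstTrue-cong : ∀ {p q : ℕ → Bool} → (∀ d → p d ≡ q d) → ∀ m → firstTrue Γ p m ≡ firstTrue Γ q m
  firstTrue-cong e zero    = refl
  firstTrue-cong e (suc m) =
    cong₂ (λ b r → if b then zero else suc r) (e zero) (firstTrue-cong (e ∘ suc) m)

  firstTrue-≤ : ∀ m (p : ℕ → Bool) → firstTrue Γ p m ≤ m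
  firstTrue-≤ zero    p = z≤n
  firstTrue-≤ (suc m) p with p zero
  ... | true  = z≤n
  ... | false = s≤s (firstTrue-≤ m (p ∘ suc))

  firstTrue-least : ∀ m (p : ℕ → Bool) j → p j ≡ true → j < m → firstTrue Γ p m ≤ j
  firstTrue-least (suc m) p j pj j<m with p zero in p0
  ... | true = z≤n
  firstTrue-least (suc m) p zero    pj j<m       | false = ⊥-elim (true≢false pj p0)
  firstTrue-least (suc m) p (suc j) pj (s≤s j<m) | false = s≤s (firstTrue-least m (p ∘ suc) j pj j<m)

  firstTrue-holds : ∀ m (p : ℕ → Bool) j → p j ≡ true → j < m → p (firstTrue Γ p m) ≡ true
  firstTrue-holds (suc m) p j pj j<m with p zero in p0
  ... | true = p0
  firstTrue-holds (suc m) p zero    pj j<m       | false = ⊥-elim (true≢false pj p0)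
  firstTrue-holds (suc m) p (suc j) pj (s≤s j<m) | false = firstTrue-holds m (p ∘ suc) j pj j<m

  firstTrue-below : ∀ m (p : ℕ → Bool) e → e < firstTrue Γ p m → p e ≡ false
  firstTrue-below (suc m) p e e< with p zero in p0
  firstTrue-below (suc m) p e       ()        | true
  firstTrue-below (suc m) p zero    e<        | false = p0
  firstTrue-below (suc m) p (suc e) (s≤s e<)  | false = firstTrue-below m (p ∘ suc) e e<

module Walks (Γ : Graph) where
  open FirstTrue Γ

  private
    V : Set
    V = Fin (n Γ)

  reach-refl : ∀ (u : V) → reach Γ 0 u u ≡ true
  reach-refl u with u ≟F u
  ... | yes _   = refl
  ... | no  u≢u = ⊥-elim (u≢u refl)

  reach-zero : ∀ (u v : V) → reach Γ 0 u v ≡ true → u ≡ v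
  reach-zero u v e with u ≟F v
  ... | yes u≡v = u≡v
  ... | no  _   = ⊥-elim (true≢false e refl)

  reach-suc : ∀ d (u v : V) → reach Γ d u v ≡ true → reach Γ (suc d) u v ≡ true
  reach-suc d u v = ∨-introˡ _

  reach-snoc : ∀ d (u w v : V) → reach Γ d u w ≡ true → adj Γ w v ≡ true → reach Γ (suc d) u v ≡ true
  reach-snoc d u w v r a = ∨-introʳ _ (anyF-intro (λ x → reach Γ d u x ∧ adj Γ x v) w (∧-intro r a))

  reach-weaken : ∀ {d e} (u v : V) → d ≤ e → reach Γ d u v ≡ true → reach Γ e u v ≡ true
  reach-weaken {e = e} u v z≤n r with reach-zero u v r
  ... | refl = lift e
    where
    lift : ∀ e → reach Γ e u u ≡ true
    lift zero    = reach-refl u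
    lift (suc e) = reach-suc e u u (lift e)
  reach-weaken u v (s≤s {d} {e} d≤e) r with ∨-split _ _ r
  ... | inj₁ r′ = reach-suc e u v (reach-weaken u v d≤e r′)
  ... | inj₂ h with anyF-witness _ h
  ...   | w , rw∧a = reach-snoc e u w v (reach-weaken u w d≤e (∧-conicalˡ _ _ rw∧a)) (∧-conicalʳ _ _ rw∧a)

  reach-cons : ∀ d (u w v : V) → adj Γ u w ≡ true → reach Γ d w v ≡ true → reach Γ (suc d) u v ≡ true
  reach-cons zero u w v a r with reach-zero w v r
  ... | refl = reach-snoc 0 u u w (reach-refl u) a
  reach-cons (suc d) u w v a r with ∨-split _ _ r
  ... | inj₁ r′ = reach-suc (suc d) u v (reach-cons d u w v a r′)
  ... | inj₂ h with anyF-witness _ h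
  ...   | x , rx∧a = reach-snoc (suc d) u x v (reach-cons d u w x a (∧-conicalˡ _ _ rx∧a)) (∧-conicalʳ _ _ rx∧a)

  reach-sym : ∀ d (u v : V) → reach Γ d u v ≡ true → reach Γ d v u ≡ true
  reach-sym zero u v r with reach-zero u v r
  ... | refl = reach-refl u
  reach-sym (suc d) u v r with ∨-split _ _ r
  ... | inj₁ r′ = reach-suc d v u (reach-sym d u v r′)
  ... | inj₂ h with anyF-witness _ h
  ...   | x , rx∧a = reach-cons d v x u (trans (adj-sym Γ v x) (∧-conicalʳ _ _ rx∧a))
                                        (reach-sym d u x (∧-conicalˡ _ _ rx∧a))

  module Automorphism (π : Permutation′ (n Γ)) (π-aut : IsAut Γ π) where

    π-injective : ∀ {u v : V} → π ⟨$⟩ʳ u ≡ π ⟨$⟩ʳ v → u ≡ v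
    π-injective = Injection.injective (↔⇒↣ π)

    reach-invariant : ∀ d (u v : V) → reach Γ d (π ⟨$⟩ʳ u) (π ⟨$⟩ʳ v) ≡ reach Γ d u v
    reach-invariant zero u v = bool-ext
      (λ e → subst (λ x → reach Γ 0 u x ≡ true) (π-injective (reach-zero _ _ e)) (reach-refl u))
      (λ e → subst (λ x → reach Γ 0 (π ⟨$⟩ʳ u) (π ⟨$⟩ʳ x) ≡ true) (reach-zero _ _ e) (reach-refl _))
    reach-invariant (suc d) u v = cong₂ _∨_ (reach-invariant d u v) (begin
      anyF (λ w → reach Γ d (π ⟨$⟩ʳ u) w ∧ adj Γ w (π ⟨$⟩ʳ v))
        ≡⟨ anyF-permute (λ w → reach Γ d (π ⟨$⟩ʳ u) w ∧ adj Γ w (π ⟨$⟩ʳ v)) π ⟨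
      anyF (λ w → reach Γ d (π ⟨$⟩ʳ u) (π ⟨$⟩ʳ w) ∧ adj Γ (π ⟨$⟩ʳ w) (π ⟨$⟩ʳ v))
        ≡⟨ anyF-cong (λ w → cong₂ _∧_ (reach-invariant d u w) (π-aut w v)) ⟩
      anyF (λ w → reach Γ d u w ∧ adj Γ w v) ∎)
      where open ≡-Reasoning

    dist-invariant : ∀ (u v : V) → dist Γ (π ⟨$⟩ʳ u) (π ⟨$⟩ʳ v) ≡ dist Γ u v
    dist-invariant u v = firstTrue-cong (λ d → reach-invariant d u v) (n Γ)

    nbrsAt-invariant : ∀ (α β : V) j → nbrsAt Γ (π ⟨$⟩ʳ α) (π ⟨$⟩ʳ β) j ≡ nbrsAt Γ α β j
    nbrsAt-invariant α β j =
      trans (sym (count-permute (λ w → adj Γ (π ⟨$⟩ʳ β) w ∧ ⌊ dist Γ (π ⟨$⟩ʳ α) w ≟ℕ j ⌋) π))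
            (count-cong (λ w → cong₂ _∧_ (π-aut β w) (cong (λ x → ⌊ x ≟ℕ j ⌋) (dist-invariant α w))))

-- Balls around u grow strictly until they stabilise, so in a graph on N
-- vertices every reachable vertex is reachable by a walk of length < N.

module Balls (Γ : Graph) (u : Fin (n Γ)) where
  open Walks Γ

  private
    V : Set
    V = Fin (n Γ)

  Stable : ℕ → Set
  Stable d = ∀ v → reach Γ (suc d) u v ≡ reach Γ d u v

  stable-suc : ∀ {d} → Stable d → Stable (suc d)
  stable-suc st v = cong₂ _∨_ (st v) (anyF-cong (λ w → cong (_∧ adj Γ w v) (st w)))

  stable-+ : ∀ m {e} → Stable e → Stable (m + e)
  stable-+ zero    st = st
  stable-+ (suc m) {e} st = stable-suc {m + e} (stable-+ m st)

  stable-forever : ∀ m {e} → Stable e → ∀ v → reach Γ (m + e) u v ≡ reach Γ e u v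
  stable-forever zero    st v = refl
  stable-forever (suc m) st v = trans (stable-+ m st v) (stable-forever m st v)

  new-or-stable : ∀ d →
    (Σ V λ v → reach Γ (suc d) u v ≡ true × reach Γ d u v ≡ false) ⊎ Stable d
  new-or-stable d with anyF (λ v → reach Γ (suc d) u v ∧ not (reach Γ d u v)) in found
  ... | true with anyF-witness _ found
  ...   | v , new = inj₁ (v , ∧-conicalˡ _ _ new , not-true (∧-conicalʳ _ _ new))
    where
    not-true : ∀ {b} → not b ≡ true → b ≡ false
    not-true {false} _ = refl
  new-or-stable d | false = inj₂ λ v → bool-ext (old v) (reach-suc d u v)
    where
    old : ∀ v → reach Γ (suc d) u v ≡ true → reach Γ d u v ≡ true
    old v r = not-false λ r′ → true≢false
      (anyF-intro (λ v → reach Γ (suc d) u v ∧ not (reach Γ d u v)) v (∧-intro r (cong not r′))) found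

  grow-or-stable : ∀ d → (suc d ≤ count (reach Γ d u)) ⊎ (Σ ℕ λ e → e ≤ d × Stable e)
  grow-or-stable zero = inj₁ (count-positive (reach Γ 0 u) u (reach-refl u))
  grow-or-stable (suc d) with grow-or-stable d
  ... | inj₂ (e , e≤d , st) = inj₂ (e , m≤n⇒m≤1+n e≤d , st)
  ... | inj₁ big with new-or-stable d
  ...   | inj₂ st = inj₂ (d , n≤1+n d , st)
  ...   | inj₁ (v , now , before) = inj₁ (≤-trans (s≤s big)
          (count-strict (reach Γ d u) (reach Γ (suc d) u) (reach-suc d u) v before now))

  fin-size : ∀ {K} → Fin K → suc (K ∸ 1) ≡ K
  fin-size {suc _} _ = refl

  short-walk : ∀ v → (Σ ℕ λ d → reach Γ d u v ≡ true) → Σ ℕ λ e → e < n Γ × reach Γ e u v ≡ true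
  short-walk v (d , r) with grow-or-stable (n Γ ∸ 1)
  ... | inj₁ big = n Γ ∸ 1 , ≤-reflexive (fin-size u) ,
        count-full _ (≤-antisym (count-≤ _) (subst (_≤ count (reach Γ (n Γ ∸ 1) u)) (fin-size u) big)) v
  ... | inj₂ (e , e≤ , st) = e , ≤-trans (s≤s e≤) (≤-reflexive (fin-size u)) , reach-e
    where
    reach-e : reach Γ e u v ≡ true
    reach-e with ≤-total d e
    ... | inj₁ d≤e = reach-weaken u v d≤e r
    ... | inj₂ e≤d = trans (sym (stable-forever (d ∸ e) st v))
                           (subst (λ x → reach Γ x u v ≡ true) (sym (m∸n+n≡m e≤d)) r)

module Distance (Γ : Graph) (conn : Connected Γ) where
  open FirstTrue Γ
  open Walks Γ

  private
    V : Set
    V = Fin (n Γ)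

  reach-dist : ∀ (u v : V) → reach Γ (dist Γ u v) u v ≡ true
  reach-dist u v with Balls.short-walk Γ u v (conn u v)
  ... | e , e<N , r = firstTrue-holds (n Γ) (λ d → reach Γ d u v) e r e<N

  dist-minimal : ∀ (u v : V) d → d < dist Γ u v → reach Γ d u v ≡ false
  dist-minimal u v = firstTrue-below (n Γ) (λ d → reach Γ d u v)

  dist-≤ : ∀ (u v : V) d → reach Γ d u v ≡ true → dist Γ u v ≤ d
  dist-≤ u v d r with d <? n Γ
  ... | yes d<N = firstTrue-least (n Γ) (λ d → reach Γ d u v) d r d<N
  ... | no  d≮N = ≤-trans (firstTrue-≤ (n Γ) _) (≮⇒≥ d≮N)

  dist-refl : ∀ (u : V) → dist Γ u u ≡ 0
  dist-refl u = n≤0⇒n≡0 (dist-≤ u u 0 (reach-refl u))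

  dist-zero : ∀ (u v : V) → dist Γ u v ≡ 0 → u ≡ v
  dist-zero u v e = reach-zero u v (subst (λ x → reach Γ x u v ≡ true) e (reach-dist u v))

  dist-sym : ∀ (u v : V) → dist Γ u v ≡ dist Γ v u
  dist-sym u v = ≤-antisym (dist-≤ u v (dist Γ v u) (reach-sym (dist Γ v u) v u (reach-dist v u)))
                           (dist-≤ v u (dist Γ u v) (reach-sym (dist Γ u v) u v (reach-dist u v)))

  dist-edgeʳ : ∀ (u w v : V) → adj Γ w v ≡ true → dist Γ u v ≤ suc (dist Γ u w)
  dist-edgeʳ u w v a = dist-≤ u v _ (reach-snoc (dist Γ u w) u w v (reach-dist u w) a)

  dist-edgeˡ : ∀ (u u′ v : V) → adj Γ u u′ ≡ true → dist Γ u v ≤ suc (dist Γ u′ v)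
  dist-edgeˡ u u′ v a = subst₂ (λ x y → x ≤ suc y) (dist-sym v u) (dist-sym v u′)
    (dist-edgeʳ v u′ u (trans (adj-sym Γ u′ u) a))

  dist-adj : ∀ (u v : V) → adj Γ u v ≡ true → dist Γ u v ≡ 1
  dist-adj u v a = ≤-antisym (subst (λ x → dist Γ u v ≤ suc x) (dist-refl u) (dist-edgeʳ u u v a)) positive
    where
    positive : 1 ≤ dist Γ u v
    positive with dist Γ u v in e
    ... | suc _ = s≤s z≤n
    ... | zero with dist-zero u v e
    ...   | refl = ⊥-elim (true≢false a (irrefl Γ u))

  geodesic-last : ∀ (u v : V) d → dist Γ u v ≡ suc d → Σ V λ w → adj Γ w v ≡ true × dist Γ u w ≡ d
  geodesic-last u v d e with ∨-split _ _ (subst (λ x → reach Γ x u v ≡ true) e (reach-dist u v))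
  ... | inj₁ r = ⊥-elim (true≢false r (dist-minimal u v d (≤-reflexive (sym e))))
  ... | inj₂ h with anyF-witness _ h
  ...   | w , rw∧a = w , aw , ≤-antisym (dist-≤ u w d (∧-conicalˡ _ _ rw∧a))
                       (≤-pred (subst (_≤ suc (dist Γ u w)) e (dist-edgeʳ u w v aw)))
    where aw = ∧-conicalʳ _ _ rw∧a

  geodesic-first : ∀ (u v : V) d → dist Γ u v ≡ suc d → Σ V λ w → adj Γ u w ≡ true × dist Γ w v ≡ d
  geodesic-first u v d e with geodesic-last v u d (trans (dist-sym v u) e)
  ... | w , a , e′ = w , trans (adj-sym Γ u w) a , trans (dist-sym w v) e′

  sphere-nonempty : ∀ (u v : V) e → e ≤ dist Γ u v → Σ V λ w → dist Γ u w ≡ e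
  sphere-nonempty u v e e≤ = go (dist Γ u v) v refl e≤
    where
    go : ∀ d (x : V) → dist Γ u x ≡ d → e ≤ d → Σ V λ w → dist Γ u w ≡ e
    go d x ux e≤d with m≤n⇒m<n∨m≡n e≤d
    ... | inj₂ refl = x , ux
    go (suc d) x ux _ | inj₁ (s≤s e≤d) = let (w , _ , uw) = geodesic-last u x d ux in go d w uw e≤d

  far-pair : ∀ d → d < diameter Γ → Σ V λ α → Σ V λ δ → dist Γ α δ ≡ suc d
  far-pair d d<diam with maxF-witness (λ u → maxF (λ v → dist Γ u v)) d d<diam
  ... | α , d<ecc with maxF-witness (dist Γ α) d d<ecc
  ...   | v , d<αv = α , sphere-nonempty α v (suc d) d<αv

  nbrsAt-towards : ∀ α α′ β j → adj Γ α α′ ≡ true → dist Γ α β ≡ suc (suc j) →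
    nbrsAt Γ α′ β j ≤ nbrsAt Γ α β (suc j)
  nbrsAt-towards α α′ β j aa αβ = count-mono _ _ inclusion
    where
    inclusion : ∀ w → (adj Γ β w ∧ ⌊ dist Γ α′ w ≟ℕ j ⌋) ≡ true →
                (adj Γ β w ∧ ⌊ dist Γ α w ≟ℕ suc j ⌋) ≡ true
    inclusion w h = ∧-intro βw (≟-complete (≤-antisym
        (≤-trans (dist-edgeˡ α α′ w aa) (s≤s (≤-reflexive α′w)))
        (≤-pred (subst (_≤ suc (dist Γ α w)) αβ (dist-edgeʳ α w β (trans (adj-sym Γ w β) βw))))))
      where
      βw  = ∧-conicalˡ _ _ h
      α′w = ≟-sound (∧-conicalʳ _ _ h)

  nbrsAt-away : ∀ α α′ β i → adj Γ α α′ ≡ true → dist Γ α′ β ≡ i →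
    nbrsAt Γ α β (suc (suc i)) ≤ nbrsAt Γ α′ β (suc i)
  nbrsAt-away α α′ β i aa α′β = count-mono _ _ inclusion
    where
    inclusion : ∀ w → (adj Γ β w ∧ ⌊ dist Γ α w ≟ℕ suc (suc i) ⌋) ≡ true →
                (adj Γ β w ∧ ⌊ dist Γ α′ w ≟ℕ suc i ⌋) ≡ true
    inclusion w h = ∧-intro βw (≟-complete (≤-antisym
        (subst (λ x → dist Γ α′ w ≤ suc x) α′β (dist-edgeʳ α′ β w βw))
        (≤-pred (subst (_≤ suc (dist Γ α′ w)) αw (dist-edgeˡ α α′ w aa)))))
      where
      βw = ∧-conicalˡ _ _ h
      αw = ≟-sound (∧-conicalʳ _ _ h)

  -- The common value of F on the pairs at distance i (taken as a maximum,
  -- which is exact when F is constant on those pairs).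
  valueOn : (V → V → ℕ) → ℕ → ℕ
  valueOn F i = maxF (λ α → maxF (λ β → if ⌊ dist Γ α β ≟ℕ i ⌋ then F α β else 0))

  valueOn-exact : ∀ F i → (∀ α β α′ β′ → dist Γ α β ≡ i → dist Γ α′ β′ ≡ i → F α β ≡ F α′ β′) →
    ∀ α β → dist Γ α β ≡ i → F α β ≡ valueOn F i
  valueOn-exact F i constant α β αβ = ≤-antisym
    (≤-trans (≤-reflexive (sym (at α β αβ)))
      (≤-trans (maxF-upper (λ β′ → if ⌊ dist Γ α β′ ≟ℕ i ⌋ then F α β′ else 0) β)
               (maxF-upper (λ α′ → maxF (λ β′ → if ⌊ dist Γ α′ β′ ≟ℕ i ⌋ then F α′ β′ else 0)) α)))
    (maxF-least _ _ λ α′ → maxF-least _ _ λ β′ → bounded α′ β′)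
    where
    at : ∀ α′ β′ → dist Γ α′ β′ ≡ i → (if ⌊ dist Γ α′ β′ ≟ℕ i ⌋ then F α′ β′ else 0) ≡ F α′ β′
    at α′ β′ e rewrite ≟-complete e = refl
    bounded : ∀ α′ β′ → (if ⌊ dist Γ α′ β′ ≟ℕ i ⌋ then F α′ β′ else 0) ≤ F α β
    bounded α′ β′ with dist Γ α′ β′ ≟ℕ i
    ... | yes e = ≤-reflexive (constant α′ β′ α β e αβ)
    ... | no  _ = z≤n

-- Intersection numbers of a (G,s)-distance-transitive graph, given a pair
-- (α₀, δ₀) at distance s+1 (which exists because s < diam Γ).

module IntersectionNumbers (Γ : Graph) (k : ℕ) (k≥1 : 1 ≤ k) (conn : Connected Γ) (reg : Regular Γ k)
    (G : Subgroup Γ) (s : ℕ) (s≥1 : 1 ≤ s) (dt : DistTransitive Γ G s)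
    (α₀ δ₀ : Fin (n Γ)) (α₀δ₀ : dist Γ α₀ δ₀ ≡ suc s) where
  open Walks Γ
  open Distance Γ conn

  private
    V : Set
    V = Fin (n Γ)

  nbrsAt-constant : ∀ i → 1 ≤ i → i ≤ s → ∀ j α β α′ β′ → dist Γ α β ≡ i → dist Γ α′ β′ ≡ i →
    nbrsAt Γ α β j ≡ nbrsAt Γ α′ β′ j
  nbrsAt-constant i 1≤i i≤s j α β α′ β′ e e′ with dt i 1≤i i≤s α β α′ β′ e e′
  ... | g , g∈G , refl , refl = sym (Automorphism.nbrsAt-invariant g (aut G g∈G) α β j)

  c a b : ℕ → ℕ
  c i = valueOn (λ α β → nbrsAt Γ α β (i ∸ 1)) i
  a i = valueOn (λ α β → nbrsAt Γ α β i) i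
  b zero    = k
  b (suc i) = valueOn (λ α β → nbrsAt Γ α β (suc (suc i))) (suc i)

  intersection-numbers : ∀ (α β : V) i → 1 ≤ i → i ≤ s → dist Γ α β ≡ i →
    (nbrsAt Γ α β (i ∸ 1) ≡ c i) × (nbrsAt Γ α β i ≡ a i) × (nbrsAt Γ α β (suc i) ≡ b i)
  intersection-numbers α β (suc i) 1≤i i≤s αβ =
    exact i , exact (suc i) , exact (suc (suc i))
    where
    exact : ∀ j → nbrsAt Γ α β j ≡ valueOn (λ α′ β′ → nbrsAt Γ α′ β′ j) (suc i)
    exact j = valueOn-exact _ _ (λ _ _ _ _ → nbrsAt-constant (suc i) 1≤i i≤s j _ _ _ _) α β αβ

  some-neighbour : ∀ v → Σ V λ w → adj Γ v w ≡ true
  some-neighbour v = count-witness (adj Γ v) (subst (1 ≤_) (sym (reg v)) k≥1)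

  -- G is vertex-transitive: it is transitive on edges, and every vertex lies on one
  vertex-transitive : ∀ α α′ → Σ (Permutation′ (n Γ)) λ g → mem G g × (g ⟨$⟩ʳ α ≡ α′)
  vertex-transitive α α′ with some-neighbour α | some-neighbour α′
  ... | β , αβ | β′ , α′β′ with dt 1 (s≤s z≤n) s≥1 α β α′ β′ (dist-adj α β αβ) (dist-adj α′ β′ α′β′)
  ...   | g , g∈G , gα , _ = g , g∈G , gα

  orbit-invariant : ∀ (α δ δ′ : V) → SameOrbitStab Γ G α δ δ′ → nbrsAt Γ α δ s ≡ nbrsAt Γ α δ′ s
  orbit-invariant α δ δ′ (g , g∈G , gα , gδ) =
    trans (sym (Automorphism.nbrsAt-invariant g (aut G g∈G) α δ s)) (cong₂ (λ x y → nbrsAt Γ x y s) gα gδ)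

  private
    InSphere : V → Bool
    InSphere δ = ⌊ dist Γ α₀ δ ≟ℕ suc s ⌋

    minimiser : Σ V λ y → InSphere y ≡ true × (∀ z → InSphere z ≡ true → nbrsAt Γ α₀ y s ≤ nbrsAt Γ α₀ z s)
    minimiser = argmin InSphere (λ δ → nbrsAt Γ α₀ δ s) δ₀ (≟-complete α₀δ₀)

  δmin : V
  δmin = proj₁ minimiser

  α₀δmin : dist Γ α₀ δmin ≡ suc s
  α₀δmin = ≟-sound (proj₁ (proj₂ minimiser))

  c′ : ℕ
  c′ = nbrsAt Γ α₀ δmin s

  δmin-minimal : ∀ δ → dist Γ α₀ δ ≡ suc s → c′ ≤ nbrsAt Γ α₀ δ s
  δmin-minimal δ α₀δ = proj₂ (proj₂ minimiser) δ (≟-complete α₀δ)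

  -- by vertex-transitivity, c′ is the minimum over Γₛ₊₁(α) for every α, and attained
  c′-minimum : ∀ (α : V) →
    (∀ (δ : V) → dist Γ α δ ≡ suc s → c′ ≤ nbrsAt Γ α δ s)
    × Σ V (λ δ → (dist Γ α δ ≡ suc s) × (nbrsAt Γ α δ s ≡ c′))
  c′-minimum α with vertex-transitive α₀ α
  ... | g , g∈G , refl = lower , g ⟨$⟩ʳ δmin , trans (dist-invariant α₀ δmin) α₀δmin , nbrsAt-invariant α₀ δmin s
    where
    open Automorphism g (aut G g∈G)
    -- transport δ back to α₀ by g⁻¹ and use minimality of δmin there
    lower : ∀ δ → dist Γ (g ⟨$⟩ʳ α₀) δ ≡ suc s → c′ ≤ nbrsAt Γ (g ⟨$⟩ʳ α₀) δ s
    lower δ gα₀δ = subst (λ x → c′ ≤ nbrsAt Γ (g ⟨$⟩ʳ α₀) x s) (inverseʳ g)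
      (subst (c′ ≤_) (sym (nbrsAt-invariant α₀ δ′ s))
        (δmin-minimal δ′ (trans (sym (dist-invariant α₀ δ′)) (subst (λ x → dist Γ (g ⟨$⟩ʳ α₀) x ≡ suc s) (sym (inverseʳ g)) gα₀δ))))
      where
      δ′ : V
      δ′ = g ⟨$⟩ˡ δ

  step-towards : ∀ i → i ≤ s → Σ V λ α′ → Σ V λ β →
    adj Γ α₀ α′ ≡ true × dist Γ α₀ β ≡ suc i × dist Γ α′ β ≡ i
  step-towards i i≤s with sphere-nonempty α₀ δ₀ (suc i) (subst (suc i ≤_) (sym α₀δ₀) (s≤s i≤s))
  ... | β , α₀β with geodesic-first α₀ β i α₀β
  ...   | α′ , aα′ , α′β = α′ , β , aα′ , α₀β , α′β

  c₁≡1 : c 1 ≡ 1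
  c₁≡1 with some-neighbour α₀
  ... | β , aβ = trans (sym (proj₁ (intersection-numbers α₀ β 1 (s≤s z≤n) s≥1 (dist-adj α₀ β aβ))))
      (count-single _ α₀ (∧-intro (trans (adj-sym Γ β α₀) aβ) (≟-complete (dist-refl α₀)))
        (λ x h → sym (dist-zero α₀ x (≟-sound (∧-conicalʳ _ _ h)))))

  c-mono : ∀ i → 1 ≤ i → i < s → c i ≤ c (suc i)
  c-mono (suc j) 1≤i i<s with step-towards (suc j) (<⇒≤ i<s)
  ... | α′ , β , aα′ , α₀β , α′β = subst₂ _≤_
      (proj₁ (intersection-numbers α′ β (suc j) 1≤i (<⇒≤ i<s) α′β))
      (proj₁ (intersection-numbers α₀ β (suc (suc j)) (s≤s z≤n) i<s α₀β))
      (nbrsAt-towards α₀ α′ β j aα′ α₀β)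

  cₛ≤c′ : c s ≤ c′
  cₛ≤c′ with geodesic-first α₀ δmin s α₀δmin
  ... | α′ , aα′ , α′δ = ≤-trans (≤-reflexive (sym (proj₁ (intersection-numbers α′ δmin s s≥1 ≤-refl α′δ))))
      (subst (λ x → nbrsAt Γ α′ δmin (s ∸ 1) ≤ nbrsAt Γ α₀ δmin x) s-1+1
        (nbrsAt-towards α₀ α′ δmin (s ∸ 1) aα′ (trans α₀δmin (cong suc (sym s-1+1)))))
    where
    s-1+1 : suc (s ∸ 1) ≡ s
    s-1+1 = m+[n∸m]≡n s≥1

  -- α₀ is a neighbour of β ∈ Γ₁(α₀) that is not in Γ₂(α₀)
  b₁<k : b 1 < k
  b₁<k with some-neighbour α₀
  ... | β , aβ = subst₂ _<_ (proj₂ (proj₂ (intersection-numbers α₀ β 1 (s≤s z≤n) s≥1 (dist-adj α₀ β aβ)))) (reg β)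
      (count-strict (λ w → adj Γ β w ∧ ⌊ dist Γ α₀ w ≟ℕ 2 ⌋) (adj Γ β) (λ w → ∧-conicalˡ _ _)
        α₀ (trans (cong (λ x → adj Γ β α₀ ∧ ⌊ x ≟ℕ 2 ⌋) (dist-refl α₀)) (∧-zeroʳ _))
        (trans (adj-sym Γ β α₀) aβ))

  b-mono : ∀ i → 1 ≤ i → i < s → b (suc i) ≤ b i
  b-mono (suc j) 1≤i i<s with step-towards (suc j) (<⇒≤ i<s)
  ... | α′ , β , aα′ , α₀β , α′β = subst₂ _≤_
      (proj₂ (proj₂ (intersection-numbers α₀ β (suc (suc j)) (s≤s z≤n) i<s α₀β)))
      (proj₂ (proj₂ (intersection-numbers α′ β (suc j) 1≤i (<⇒≤ i<s) α′β)))
      (nbrsAt-away α₀ α′ β (suc j) aα′ α′β)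

lemma2p4 : (Γ : Graph) (k : ℕ) → 3 ≤ k → Connected Γ → Regular Γ k →
    (G : Subgroup Γ) (s : ℕ) → 1 ≤ s → DistTransitive Γ G s → s < diameter Γ →
    Σ (ℕ → ℕ) λ c → Σ (ℕ → ℕ) λ a → Σ (ℕ → ℕ) λ b → Σ ℕ λ c′ →
    (∀ (α β : Fin (n Γ)) (i : ℕ) → 1 ≤ i → i ≤ s → dist Γ α β ≡ i →
    (nbrsAt Γ α β (i ∸ 1) ≡ c i) × (nbrsAt Γ α β i ≡ a i) × (nbrsAt Γ α β (suc i) ≡ b i))
    × (∀ (α δ δ′ : Fin (n Γ)) → dist Γ α δ ≡ suc s → SameOrbitStab Γ G α δ δ′ →
    nbrsAt Γ α δ s ≡ nbrsAt Γ α δ′ s)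
    × (∀ (α : Fin (n Γ)) →
    (∀ (δ : Fin (n Γ)) → dist Γ α δ ≡ suc s → c′ ≤ nbrsAt Γ α δ s)
    × Σ (Fin (n Γ)) (λ δ → (dist Γ α δ ≡ suc s) × (nbrsAt Γ α δ s ≡ c′)))
    × (b 0 ≡ k)
    × (c 1 ≡ 1) × (∀ i → 1 ≤ i → i < s → c i ≤ c (suc i)) × (c s ≤ c′)
    × (b 1 < k) × (∀ i → 1 ≤ i → i < s → b (suc i) ≤ b i)
lemma2p4 Γ k k≥3 conn reg G s s≥1 dt s<diam =
  let (α₀ , δ₀ , α₀δ₀) = Distance.far-pair Γ conn s s<diam
      open IntersectionNumbers Γ k (≤-trans (s≤s z≤n) k≥3) conn reg G s s≥1 dt α₀ δ₀ α₀δ₀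
  in c , a , b , c′ , intersection-numbers , (λ α δ δ′ _ → orbit-invariant α δ δ′) , c′-minimum ,
     refl , c₁≡1 , c-mono , cₛ≤c′ , b₁<k , b-mono
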